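{- Let $t,k,n$ be positive integers with $k\equiv 1\pmod 2$, $n\equiv 0 \pmod 2$ and $n\geq 2t+6$. Then the graph $K_t\vee(K_{n-2t-3}\cup K_3\cup tK_1)$ has no perfect $k$-matching.
   Context: All graphs are finite and simple. $K_m$ is the complete graph on $m$ vertices; $G_1\cup G_2$ is the disjoint union, $mH$ is the disjoint union of $m$ copies of $H$, and $G_1\vee G_2$ (the join) is obtained from $G_1\cup G_2$ by adding all edges between a vertex of $G_1$ and a vertex of $G_2$. For a vertex $v$, $E_G(v)$ is the set of edges incident with $v$. A perfect $k$-matching of $G$ is a function $f:E(G)\to\{0,1,\ldots,k\}$ with $\sum_{e\in E_G(v)} f(e)=k$ for every vertex $v$. -}

module Defs where

open import Data.Nat using (ℕ; zero; suc; _+_; _≤_)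
open import Data.Fin using (Fin; splitAt; _≟_)
open import Data.Sum using (_⊎_; inj₁; inj₂)
open import Data.Bool using (Bool; true; false; not)
open import Data.List using (tabulate)
open import Data.Nat.ListAction using (sum)
open import Data.Product using (Σ; _×_)
open import Relation.Nullary.Decidable using (⌊_⌋)
open import Relation.Binary.PropositionalEquality using (_≡_)

record Graph : Set where
  constructor mkGraph
  field
    V   : ℕ
    adj : Fin V → Fin V → Bool

open Graph public

K : ℕ → Graph
K m = mkGraph m (λ u v → not ⌊ u ≟ v ⌋)

_∪ᴳ_ : Graph → Graph → Graph
G₁ ∪ᴳ G₂ = mkGraph (V G₁ + V G₂) a
  where
  a : Fin (V G₁ + V G₂) → Fin (V G₁ + V G₂) → Bool
  a u v with splitAt (V G₁) u | splitAt (V G₁) v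
  ... | inj₁ x | inj₁ y = adj G₁ x y
  ... | inj₂ x | inj₂ y = adj G₂ x y
  ... | inj₁ _ | inj₂ _ = false
  ... | inj₂ _ | inj₁ _ = false

_∨ᴳ_ : Graph → Graph → Graph
G₁ ∨ᴳ G₂ = mkGraph (V G₁ + V G₂) a
  where
  a : Fin (V G₁ + V G₂) → Fin (V G₁ + V G₂) → Bool
  a u v with splitAt (V G₁) u | splitAt (V G₁) v
  ... | inj₁ x | inj₁ y = adj G₁ x y
  ... | inj₂ x | inj₂ y = adj G₂ x y
  ... | inj₁ _ | inj₂ _ = true
  ... | inj₂ _ | inj₁ _ = true

K₀ : Graph
K₀ = mkGraph 0 (λ ())

_·ᴳ_ : ℕ → Graph → Graph
zero  ·ᴳ H = K₀
suc m ·ᴳ H = H ∪ᴳ (m ·ᴳ H)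

-- The edge function is represented as a symmetric function on pairs of
-- vertices that vanishes on non-adjacent pairs (an edge {u,v} has value
-- f u v = f v u); the sum over E_G(v) is then the sum of f v u over all u.
PerfectKMatching : Graph → ℕ → Set
PerfectKMatching G k =
  Σ (Fin (V G) → Fin (V G) → ℕ) λ f →
    (∀ u v → f u v ≡ f v u) ×
    (∀ u v → adj G u v ≡ false → f u v ≡ 0) ×
    (∀ u v → f u v ≤ k) ×
    (∀ v → sum (tabulate (f v)) ≡ k)

-- The t isolated vertices can only send weight into K_t, and together they need t·k of it,
-- which is all the weight K_t has. Hence K_t sends nothing to the rest of the graph, so the
-- triangle K_3 inherits a perfect k-matching of its own. That is impossible for odd k, since
-- summing the vertex conditions counts every edge twice, so (order)·k must be even.
module Submission where

open import Defs
open import Data.Nat using (ℕ; zero; suc; _+_; _*_; _∸_; _≤_; _%_)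
open import Data.Nat.Properties
  using (+-0-commutativeMonoid; +-assoc; +-identityʳ; +-cancelʳ-≡; *-identityʳ; m+n≡0⇒m≡0; m+n≡0⇒n≡0)
open import Data.Nat.DivMod using (%-distribˡ-*)
open import Data.Nat.Divisibility using (_∣_; _∣0; m∣m*n; ∣m∣n⇒∣m+n; n∣m⇒m%n≡0)
open import Data.Nat.ListAction using (sum)
open import Algebra.Properties.CommutativeMonoid.Sum +-0-commutativeMonoid
  using (sum-syntax; sum-cong-≗; sum-replicate-zero; ∑-distrib-+; ∑-comm)
open import Data.Fin using (Fin; zero; suc; _↑ˡ_; _↑ʳ_; splitAt; _≟_)
open import Data.Fin.Properties using (splitAt-↑ˡ; splitAt-↑ʳ)
open import Data.List using (tabulate)
open import Data.Sum using (inj₁; inj₂)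
open import Data.Bool using (false; not)
open import Data.Product using (_,_; proj₁; proj₂)
open import Function using (_∘_)
open import Relation.Nullary using (¬_; contradiction)
open import Relation.Nullary.Decidable using (isYes≗does; dec-true)
open import Relation.Binary.PropositionalEquality
  using (_≡_; refl; sym; trans; cong; cong₂; subst; module ≡-Reasoning)

open ≡-Reasoning

∑-tabulate : ∀ {n} (g : Fin n → ℕ) → sum (tabulate g) ≡ ∑[ i < n ] g i
∑-tabulate {zero}  g = refl
∑-tabulate {suc n} g = cong (g zero +_) (∑-tabulate (g ∘ suc))

∑-const : ∀ n k → ∑[ i < n ] k ≡ n * k
∑-const zero    k = refl
∑-const (suc n) k = cong (k +_) (∑-const n k)

∑-zero : ∀ {n} {g : Fin n → ℕ} → (∀ i → g i ≡ 0) → ∑[ i < n ] g i ≡ 0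
∑-zero {n} g≡0 = trans (sum-cong-≗ g≡0) (sum-replicate-zero n)

∑≡0⇒≡0 : ∀ {n} (g : Fin n → ℕ) → ∑[ i < n ] g i ≡ 0 → ∀ i → g i ≡ 0
∑≡0⇒≡0 g ∑≡0 zero    = m+n≡0⇒m≡0 (g zero) ∑≡0
∑≡0⇒≡0 g ∑≡0 (suc i) = ∑≡0⇒≡0 (g ∘ suc) (m+n≡0⇒n≡0 (g zero) ∑≡0) i

∑-↑ : ∀ m {n} (g : Fin (m + n) → ℕ) →
      ∑[ i < m + n ] g i ≡ ∑[ i < m ] g (i ↑ˡ n) + ∑[ j < n ] g (m ↑ʳ j)
∑-↑ zero    g = refl
∑-↑ (suc m) g = trans (cong (g zero +_) (∑-↑ m (g ∘ suc))) (sym (+-assoc (g zero) _ _))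

∑-↑ˡ-only : ∀ m {n} (g : Fin (m + n) → ℕ) → (∀ j → g (m ↑ʳ j) ≡ 0) →
            ∑[ i < m + n ] g i ≡ ∑[ i < m ] g (i ↑ˡ n)
∑-↑ˡ-only m {n} g g≡0 = begin
  ∑[ i < m + n ] g i                            ≡⟨ ∑-↑ m g ⟩
  ∑[ i < m ] g (i ↑ˡ n) + ∑[ j < n ] g (m ↑ʳ j) ≡⟨ cong (∑[ i < m ] g (i ↑ˡ n) +_) (∑-zero g≡0) ⟩
  ∑[ i < m ] g (i ↑ˡ n) + 0                     ≡⟨ +-identityʳ _ ⟩
  ∑[ i < m ] g (i ↑ˡ n)                         ∎

∑-↑ʳ-only : ∀ m {n} (g : Fin (m + n) → ℕ) → (∀ i → g (i ↑ˡ n) ≡ 0) →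
            ∑[ i < m + n ] g i ≡ ∑[ j < n ] g (m ↑ʳ j)
∑-↑ʳ-only m {n} g g≡0 = trans (∑-↑ m g) (cong (_+ ∑[ j < n ] g (m ↑ʳ j)) (∑-zero g≡0))

2∣∑∑-symmetric : ∀ {n} (f : Fin n → Fin n → ℕ) →
                 (∀ u v → f u v ≡ f v u) → (∀ v → f v v ≡ 0) →
                 2 ∣ ∑[ u < n ] ∑[ v < n ] f u v
2∣∑∑-symmetric {zero}  f f-sym f-diag = 2 ∣0
2∣∑∑-symmetric {suc n} f f-sym f-diag =
  subst (2 ∣_) (sym split)
    (∣m∣n⇒∣m+n (m∣m*n r) (2∣∑∑-symmetric (λ u v → f (suc u) (suc v)) (λ u v → f-sym _ _) (f-diag ∘ suc)))
  where
  r    = ∑[ v < n ] f zero (suc v)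
  rest = ∑[ u < n ] ∑[ v < n ] f (suc u) (suc v)
  split : ∑[ u < suc n ] ∑[ v < suc n ] f u v ≡ 2 * r + rest
  split = begin
    (f zero zero + r) + ∑[ u < n ] (f (suc u) zero + ∑[ v < n ] f (suc u) (suc v))
      ≡⟨ cong₂ _+_ (cong (_+ r) (f-diag zero)) (∑-distrib-+ (λ u → f (suc u) zero) _) ⟩
    r + (∑[ u < n ] f (suc u) zero + rest)
      ≡⟨ cong (λ s → r + (s + rest)) (sum-cong-≗ (λ u → f-sym (suc u) zero)) ⟩
    r + (r + rest)
      ≡⟨ sym (+-assoc r r rest) ⟩
    (r + r) + rest
      ≡⟨ cong (λ s → r + s + rest) (sym (+-identityʳ r)) ⟩
    2 * r + rest ∎

Loopless : Graph → Set
Loopless G = ∀ v → adj G v v ≡ false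

Edgeless : Graph → Set
Edgeless G = ∀ u v → adj G u v ≡ false

handshake : ∀ {G k} (M : PerfectKMatching G k) → ∑[ u < V G ] ∑[ v < V G ] proj₁ M u v ≡ V G * k
handshake {G} {k} (f , _ , _ , _ , f-deg) =
  trans (sum-cong-≗ (λ u → trans (sym (∑-tabulate (f u))) (f-deg u))) (∑-const (V G) k)

no-perfect-matching-of-odd-order : ∀ {G k} → Loopless G → V G % 2 ≡ 1 → k % 2 ≡ 1 →
                                   ¬ PerfectKMatching G k
no-perfect-matching-of-odd-order {G} {k} G-loopless G-odd k-odd M@(f , f-sym , f-off , _ , _)
  = contradiction (trans (sym odd) (n∣m⇒m%n≡0 (V G * k) 2 even)) λ ()
  where
  even : 2 ∣ V G * k
  even = subst (2 ∣_) (handshake M) (2∣∑∑-symmetric f f-sym (λ v → f-off v v (G-loopless v)))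
  odd : V G * k % 2 ≡ 1
  odd = trans (%-distribˡ-* (V G) k 2) (cong₂ (λ a b → a * b % 2) G-odd k-odd)

K-loopless : ∀ m → Loopless (K m)
K-loopless m v = cong not (trans (isYes≗does (v ≟ v)) (dec-true (v ≟ v) refl))

K1-edgeless : Edgeless (K 1)
K1-edgeless zero zero = refl

∪ᴳ-edgeless : ∀ {G₁ G₂} → Edgeless G₁ → Edgeless G₂ → Edgeless (G₁ ∪ᴳ G₂)
∪ᴳ-edgeless {G₁} e₁ e₂ u v with splitAt (V G₁) u | splitAt (V G₁) v
... | inj₁ x | inj₁ y = e₁ x y
... | inj₁ _ | inj₂ _ = refl
... | inj₂ _ | inj₁ _ = refl
... | inj₂ x | inj₂ y = e₂ x y

·ᴳ-edgeless : ∀ {H} → Edgeless H → ∀ t → Edgeless (t ·ᴳ H)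
·ᴳ-edgeless H-edgeless zero    ()
·ᴳ-edgeless H-edgeless (suc t) = ∪ᴳ-edgeless H-edgeless (·ᴳ-edgeless H-edgeless t)

·ᴳ-order : ∀ t H → V (t ·ᴳ H) ≡ t * V H
·ᴳ-order zero    H = refl
·ᴳ-order (suc t) H = cong (V H +_) (·ᴳ-order t H)

adj-∪ᴳ-↑ˡ-↑ˡ : ∀ G₁ G₂ x y → adj (G₁ ∪ᴳ G₂) (x ↑ˡ V G₂) (y ↑ˡ V G₂) ≡ adj G₁ x y
adj-∪ᴳ-↑ˡ-↑ˡ G₁ G₂ x y rewrite splitAt-↑ˡ (V G₁) x (V G₂) | splitAt-↑ˡ (V G₁) y (V G₂) = refl

adj-∪ᴳ-↑ʳ-↑ʳ : ∀ G₁ G₂ x y → adj (G₁ ∪ᴳ G₂) (V G₁ ↑ʳ x) (V G₁ ↑ʳ y) ≡ adj G₂ x y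
adj-∪ᴳ-↑ʳ-↑ʳ G₁ G₂ x y rewrite splitAt-↑ʳ (V G₁) (V G₂) x | splitAt-↑ʳ (V G₁) (V G₂) y = refl

adj-∪ᴳ-↑ʳ-↑ˡ : ∀ G₁ G₂ x y → adj (G₁ ∪ᴳ G₂) (V G₁ ↑ʳ x) (y ↑ˡ V G₂) ≡ false
adj-∪ᴳ-↑ʳ-↑ˡ G₁ G₂ x y rewrite splitAt-↑ʳ (V G₁) (V G₂) x | splitAt-↑ˡ (V G₁) y (V G₂) = refl

adj-∨ᴳ-↑ʳ-↑ʳ : ∀ G₁ G₂ x y → adj (G₁ ∨ᴳ G₂) (V G₁ ↑ʳ x) (V G₁ ↑ʳ y) ≡ adj G₂ x y
adj-∨ᴳ-↑ʳ-↑ʳ G₁ G₂ x y rewrite splitAt-↑ʳ (V G₁) (V G₂) x | splitAt-↑ʳ (V G₁) (V G₂) y = refl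

perfect-matching-∪ᴳʳ : ∀ {G₁ G₂ k} → PerfectKMatching (G₁ ∪ᴳ G₂) k → PerfectKMatching G₂ k
perfect-matching-∪ᴳʳ {G₁} {G₂} {k} (f , f-sym , f-off , f-≤ , f-deg) =
  g , (λ x y → f-sym _ _) , (λ x y → f-off _ _ ∘ trans (adj-∪ᴳ-↑ʳ-↑ʳ G₁ G₂ x y)) , (λ x y → f-≤ _ _) , g-deg
  where
  g : Fin (V G₂) → Fin (V G₂) → ℕ
  g x y = f (V G₁ ↑ʳ x) (V G₁ ↑ʳ y)
  g-deg : ∀ x → sum (tabulate (g x)) ≡ k
  g-deg x = begin
    sum (tabulate (g x))               ≡⟨ ∑-tabulate (g x) ⟩
    ∑[ y < V G₂ ] g x y                ≡⟨ ∑-↑ʳ-only (V G₁) (f (V G₁ ↑ʳ x)) (λ y → f-off _ _ (adj-∪ᴳ-↑ʳ-↑ˡ G₁ G₂ x y)) ⟨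
    ∑[ w < V G₁ + V G₂ ] f (V G₁ ↑ʳ x) w ≡⟨ ∑-tabulate (f (V G₁ ↑ʳ x)) ⟨
    sum (tabulate (f (V G₁ ↑ʳ x)))     ≡⟨ f-deg (V G₁ ↑ʳ x) ⟩
    k                                  ∎

module JoinWithIsolated {A H I : Graph} {k : ℕ} (I-edgeless : Edgeless I) (∣I∣≡∣A∣ : V I ≡ V A)
                        (M : PerfectKMatching (A ∨ᴳ (H ∪ᴳ I)) k) where

  G : Graph
  G = A ∨ᴳ (H ∪ᴳ I)

  f : Fin (V G) → Fin (V G) → ℕ
  f = proj₁ M

  f-sym : ∀ u v → f u v ≡ f v u
  f-sym = proj₁ (proj₂ M)

  f-off : ∀ u v → adj G u v ≡ false → f u v ≡ 0
  f-off = proj₁ (proj₂ (proj₂ M))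

  f-≤ : ∀ u v → f u v ≤ k
  f-≤ = proj₁ (proj₂ (proj₂ (proj₂ M)))

  f-deg : ∀ v → sum (tabulate (f v)) ≡ k
  f-deg = proj₂ (proj₂ (proj₂ (proj₂ M)))

  inA : Fin (V A) → Fin (V G)
  inA a = a ↑ˡ (V H + V I)

  inH : Fin (V H) → Fin (V G)
  inH h = V A ↑ʳ (h ↑ˡ V I)

  inI : Fin (V I) → Fin (V G)
  inI i = V A ↑ʳ (V H ↑ʳ i)

  degree : ∀ v → ∑[ u < V G ] f v u ≡ k
  degree v = trans (sym (∑-tabulate (f v))) (f-deg v)

  degree-split : ∀ v → ∑[ u < V G ] f v u ≡
                 ∑[ a < V A ] f v (inA a) + (∑[ h < V H ] f v (inH h) + ∑[ i < V I ] f v (inI i))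
  degree-split v = trans (∑-↑ (V A) (f v)) (cong (∑[ a < V A ] f v (inA a) +_) (∑-↑ (V H) (f v ∘ (V A ↑ʳ_))))

  I-row : ∀ i → ∑[ a < V A ] f (inI i) (inA a) ≡ k
  I-row i = begin
    ∑[ a < V A ] f (inI i) (inA a)
      ≡⟨ +-identityʳ _ ⟨
    ∑[ a < V A ] f (inI i) (inA a) + (0 + 0)
      ≡⟨ cong (∑[ a < V A ] f (inI i) (inA a) +_) (cong₂ _+_ (∑-zero I-H) (∑-zero I-I)) ⟨
    ∑[ a < V A ] f (inI i) (inA a) + (∑[ h < V H ] f (inI i) (inH h) + ∑[ j < V I ] f (inI i) (inI j))
      ≡⟨ degree-split (inI i) ⟨
    ∑[ u < V G ] f (inI i) u
      ≡⟨ degree (inI i) ⟩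
    k ∎
    where
    I-H : ∀ h → f (inI i) (inH h) ≡ 0
    I-H h = f-off _ _ (trans (adj-∨ᴳ-↑ʳ-↑ʳ A (H ∪ᴳ I) _ _) (adj-∪ᴳ-↑ʳ-↑ˡ H I i h))
    I-I : ∀ j → f (inI i) (inI j) ≡ 0
    I-I j = f-off _ _ (trans (adj-∨ᴳ-↑ʳ-↑ʳ A (H ∪ᴳ I) _ _) (trans (adj-∪ᴳ-↑ʳ-↑ʳ H I i j) (I-edgeless i j)))

  A-to-I : ∑[ a < V A ] ∑[ i < V I ] f (inA a) (inI i) ≡ V A * k
  A-to-I = begin
    ∑[ a < V A ] ∑[ i < V I ] f (inA a) (inI i) ≡⟨ ∑-comm (λ a i → f (inA a) (inI i)) ⟩
    ∑[ i < V I ] ∑[ a < V A ] f (inA a) (inI i) ≡⟨ sum-cong-≗ (λ i → sum-cong-≗ (λ a → f-sym (inA a) (inI i))) ⟩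
    ∑[ i < V I ] ∑[ a < V A ] f (inI i) (inA a) ≡⟨ sum-cong-≗ I-row ⟩
    ∑[ i < V I ] k                              ≡⟨ ∑-const (V I) k ⟩
    V I * k                                     ≡⟨ cong (_* k) ∣I∣≡∣A∣ ⟩
    V A * k                                     ∎

  A-to-H-vanishes : ∀ a h → f (inA a) (inH h) ≡ 0
  A-to-H-vanishes a h =
    ∑≡0⇒≡0 (λ h → f (inA a) (inH h))
      (m+n≡0⇒n≡0 (∑[ a′ < V A ] f (inA a) (inA a′)) (∑≡0⇒≡0 (λ a → inner a + outH a) A-rest-vanishes a)) h
    where
    inner outH outI : Fin (V A) → ℕ
    inner a = ∑[ a′ < V A ] f (inA a) (inA a′)
    outH  a = ∑[ h < V H ] f (inA a) (inH h)
    outI  a = ∑[ i < V I ] f (inA a) (inI i)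
    A-rest-vanishes : ∑[ a < V A ] (inner a + outH a) ≡ 0
    A-rest-vanishes = +-cancelʳ-≡ (V A * k) _ 0 (begin
      ∑[ a < V A ] (inner a + outH a) + V A * k               ≡⟨ cong (∑[ a < V A ] (inner a + outH a) +_) A-to-I ⟨
      ∑[ a < V A ] (inner a + outH a) + ∑[ a < V A ] outI a   ≡⟨ ∑-distrib-+ (λ a → inner a + outH a) outI ⟨
      ∑[ a < V A ] (inner a + outH a + outI a)                ≡⟨ sum-cong-≗ (λ a → +-assoc (inner a) _ _) ⟩
      ∑[ a < V A ] (inner a + (outH a + outI a))              ≡⟨ sum-cong-≗ (λ a → degree-split (inA a)) ⟨
      ∑[ a < V A ] ∑[ u < V G ] f (inA a) u                   ≡⟨ sum-cong-≗ (degree ∘ inA) ⟩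
      ∑[ a < V A ] k                                          ≡⟨ ∑-const (V A) k ⟩
      V A * k                                                 ∎)

  restriction : PerfectKMatching H k
  restriction = g , (λ h h′ → f-sym _ _) , g-off , (λ h h′ → f-≤ _ _) , g-deg
    where
    g : Fin (V H) → Fin (V H) → ℕ
    g h h′ = f (inH h) (inH h′)
    g-off : ∀ h h′ → adj H h h′ ≡ false → g h h′ ≡ 0
    g-off h h′ e = f-off _ _ (trans (adj-∨ᴳ-↑ʳ-↑ʳ A (H ∪ᴳ I) _ _) (trans (adj-∪ᴳ-↑ˡ-↑ˡ H I h h′) e))
    g-deg : ∀ h → sum (tabulate (g h)) ≡ k
    g-deg h = begin
      sum (tabulate (g h))                               ≡⟨ ∑-tabulate (g h) ⟩
      ∑[ h′ < V H ] g h h′                               ≡⟨ ∑-↑ˡ-only (V H) (f (inH h) ∘ (V A ↑ʳ_)) H-to-I ⟨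
      ∑[ w < V H + V I ] f (inH h) (V A ↑ʳ w)            ≡⟨ ∑-↑ʳ-only (V A) (f (inH h)) H-to-A ⟨
      ∑[ u < V G ] f (inH h) u                           ≡⟨ degree (inH h) ⟩
      k                                                  ∎
      where
      H-to-A : ∀ a → f (inH h) (inA a) ≡ 0
      H-to-A a = trans (f-sym _ _) (A-to-H-vanishes a h)
      H-to-I : ∀ i → f (inH h) (inI i) ≡ 0
      H-to-I i = trans (f-sym _ _)
        (f-off _ _ (trans (adj-∨ᴳ-↑ʳ-↑ʳ A (H ∪ᴳ I) _ _) (adj-∪ᴳ-↑ʳ-↑ˡ H I i h)))

lemma2p7 : (t k n : ℕ) → 1 ≤ t → 1 ≤ k → 1 ≤ n →
           k % 2 ≡ 1 → n % 2 ≡ 0 → 2 * t + 6 ≤ n →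
           ¬ PerfectKMatching (K t ∨ᴳ ((K (n ∸ (2 * t) ∸ 3) ∪ᴳ K 3) ∪ᴳ (t ·ᴳ K 1))) k
-- The arithmetic hypotheses on t and n only make the graph the paper's one; the triangle
-- alone is the obstruction.
lemma2p7 t k n _ _ _ k-odd _ _ M =
  no-perfect-matching-of-odd-order (K-loopless 3) refl k-odd
    (perfect-matching-∪ᴳʳ (JoinWithIsolated.restriction isolated-edgeless isolated-count M))
  where
  isolated-edgeless : Edgeless (t ·ᴳ K 1)
  isolated-edgeless = ·ᴳ-edgeless K1-edgeless t
  isolated-count : V (t ·ᴳ K 1) ≡ t
  isolated-count = trans (·ᴳ-order t (K 1)) (*-identityʳ t)
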